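{- Let $\lambda,\mu$ be integer partitions with $\lambda_i\ge\mu_i$ for all $i$, and let $\mathbf{1}=(1,\dots,1)$ have $|\lambda|-|\mu|$ parts. Then every integral point of $\mathcal{P}_{\lambda/\mu,\mathbf{1}}$ is a vertex of $\mathcal{P}_{\lambda/\mu,\mathbf{1}}$.
   Context: For a composition $\mathbf{w}=(w_1,\dots,w_{m-1})$ of positive integers, a Gelfand--Tsetlin (GT) pattern is a real array $(x^i_j)_{1\le i\le m,\,1\le j\le n}$ ($n$ at least the length of $\lambda$, partitions padded with zeros) with $x^{i+1}_j\ge x^i_j$ and $x^i_j\ge x^{i+1}_{j+1}$ whenever defined; $\mathcal{P}_{\lambda/\mu,\mathbf{w}}\subset\mathbb{R}^{mn}$ is the polytope of GT patterns with $\mathbf{x}^m=\lambda$, $\mathbf{x}^1=\mu$, and $\sum_jx^{i+1}_j-\sum_jx^i_j=w_i$ for $i=1,\dots,m-1$. An integral point is a pattern with all entries integers.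
   Formalization: The polytope $\mathcal{P}_{\lambda/\mu,\mathbf{1}}$ is taken in ℚ^(mn) instead of $\mathbb{R}^{mn}$, and the vertex condition considers only rational points and rational weights of convex combinations. -}

module Defs where

open import Data.Nat as ℕ using (ℕ; zero; suc)
open import Data.Integer as ℤ using (ℤ; +_)
open import Data.Rational as ℚ using (ℚ; _≤_; _<_; _+_; _*_; _-_; 0ℚ; 1ℚ; _/_)
open import Data.Fin using (Fin; zero; suc; toℕ; inject₁)
open import Data.Vec using (Vec; lookup)
open import Data.Product using (Σ; ∃; _×_)
open import Relation.Binary.PropositionalEquality using (_≡_)

sumℕ : ∀ n → (Fin n → ℕ) → ℕ
sumℕ zero    f = 0
sumℕ (suc n) f = f zero ℕ.+ sumℕ n (λ j → f (suc j))

sumℚ : ∀ n → (Fin n → ℚ) → ℚ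
sumℚ zero    f = 0ℚ
sumℚ (suc n) f = f zero + sumℚ n (λ j → f (suc j))

-- A partition with at most n parts, padded with zeros to length n:
-- a weakly decreasing vector of naturals of length n.
IsPartition : ∀ {n} → Vec ℕ n → Set
IsPartition {n} l = ∀ (j j' : Fin n) → toℕ j' ≡ suc (toℕ j) → lookup l j' ℕ.≤ lookup l j

size : ∀ {n} → Vec ℕ n → ℕ
size {n} l = sumℕ n (lookup l)

ℕtoℚ : ℕ → ℚ
ℕtoℚ k = (+ k) / 1

-- A real (here: rational) array with m = suc k rows (row index i = 0..k
-- stands for superscript i+1) and n columns.
Array : ℕ → ℕ → Set
Array k n = Fin (suc k) → Fin n → ℚ

rowSum : ∀ {k n} → Array k n → Fin (suc k) → ℚ
rowSum {k} {n} x i = sumℚ n (x i)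

IsGT : ∀ {k n} → Array k n → Set
IsGT {k} {n} x =
  (∀ (i : Fin k) (j : Fin n) → x (inject₁ i) j ≤ x (suc i) j) ×
  (∀ (i : Fin k) (j j' : Fin n) → toℕ j' ≡ suc (toℕ j) → x (suc i) j' ≤ x (inject₁ i) j)

InGTPolytope : ∀ {k n} → (lam mu : Vec ℕ n) → (w : Fin k → ℕ) → Array k n → Set
InGTPolytope {k} {n} lam mu w x =
  IsGT x ×
  (∀ j → x (Data.Fin.fromℕ k) j ≡ ℕtoℚ (lookup lam j)) ×
  (∀ j → x zero j ≡ ℕtoℚ (lookup mu j)) ×
  (∀ (i : Fin k) → rowSum x (suc i) - rowSum x (inject₁ i) ≡ ℕtoℚ (w i))

ones : ∀ k → Fin k → ℕ
ones k _ = 1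

IsIntegral : ∀ {k n} → Array k n → Set
IsIntegral {k} {n} x = ∀ i j → ∃ λ (z : ℤ) → x i j ≡ z / 1

IsVertex : ∀ {k n} → (Array k n → Set) → Array k n → Set
IsVertex {k} {n} P x =
  P x ×
  (∀ (y z : Array k n) (t : ℚ) → P y → P z → 0ℚ < t → t < 1ℚ →
     (∀ i j → x i j ≡ t * y i j + (1ℚ - t) * z i j) →
     (∀ i j → y i j ≡ x i j) × (∀ i j → z i j ≡ x i j))

{-# OPTIONS --safe #-}

-- The row differences x^{i+1} - x^i of a point of P_{λ/μ,1} have nonnegative
-- entries summing to 1, so their entries lie in [0,1]; for an integral
-- point they are integers, hence 0 or 1, which are extreme points of [0,1].  So if
-- x = t y + (1 - t) z with y, z in the polytope, the row differences of y and z
-- coincide with those of x, and as all three share the bottom row μ, y = z = x.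
module Submission where

open import Defs
open import Data.Nat using (ℕ; _≤_; _∸_; zero; suc; s≤s)
open import Data.Vec using (Vec; lookup)
open import Data.Fin using (Fin; zero; suc; inject₁)
open import Data.Fin.Induction using (<-weakInduction)
open import Data.Integer as ℤ using (+_; +0; +[1+_]; -[1+_])
import Data.Integer.Properties as ℤ
import Data.Nat.Coprimality as Coprime
open import Data.Rational using (ℚ; mkℚ; _+_; _*_; _-_; -_; 0ℚ; 1ℚ; _/_; *≤*; positive; nonNegative)
  renaming (_≤_ to _≤ℚ_; _<_ to _<ℚ_)
open import Data.Rational.Properties
open import Data.Rational.Solver using (module +-*-Solver)
open import Algebra.Properties.Group +-0-group using (x∙y⁻¹≈ε⇒x≈y; ∙-cancelʳ)
open import Data.Sum using (_⊎_; inj₁; inj₂)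
open import Data.Product using (_×_; _,_; proj₁; proj₂; ∃)
open import Function using (_∘_)
open import Relation.Binary.PropositionalEquality

/1-mkℚ : ∀ z → z / 1 ≡ mkℚ z 0 (Coprime.sym (Coprime.1-coprimeTo ℤ.∣ z ∣))
/1-mkℚ z = ↥p/↧p≡p (mkℚ z 0 _)

/1-cancel-≤ : ∀ {a b} → a / 1 ≤ℚ b / 1 → a ℤ.≤ b
/1-cancel-≤ {a} {b} a≤b rewrite /1-mkℚ a | /1-mkℚ b with a≤b
... | *≤* a*1≤b*1 = subst₂ ℤ._≤_ (ℤ.*-identityʳ a) (ℤ.*-identityʳ b) a*1≤b*1

/1-homo-+ : ∀ a b → a / 1 + b / 1 ≡ (a ℤ.+ b) / 1
/1-homo-+ a b rewrite /1-mkℚ a | /1-mkℚ b =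
  /-cong (cong₂ ℤ._+_ (ℤ.*-identityʳ a) (ℤ.*-identityʳ b)) refl

/1-homo-neg : ∀ a → - (a / 1) ≡ (ℤ.- a) / 1
/1-homo-neg a rewrite /1-mkℚ a | /1-mkℚ (ℤ.- a) with a
... | +0       = refl
... | +[1+ n ] = refl
... | -[1+ n ] = refl

/1-homo-− : ∀ a b → a / 1 - b / 1 ≡ (a ℤ.- b) / 1
/1-homo-− a b = trans (cong (_+_ (a / 1)) (/1-homo-neg b)) (/1-homo-+ a (ℤ.- b))

IsInteger : ℚ → Set
IsInteger q = ∃ λ z → q ≡ z / 1

IsInteger-− : ∀ {p q} → IsInteger p → IsInteger q → IsInteger (p - q)
IsInteger-− (a , refl) (b , refl) = a ℤ.- b , /1-homo-− a b

integer∈[0,1]⇒0∨1 : ∀ {q} → IsInteger q → 0ℚ ≤ℚ q → q ≤ℚ 1ℚ → q ≡ 0ℚ ⊎ q ≡ 1ℚ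
integer∈[0,1]⇒0∨1 (z , refl) 0≤z z≤1 with z | /1-cancel-≤ {+ 0} {z} 0≤z | /1-cancel-≤ {z} {+ 1} z≤1
... | +0           | _ | _              = inj₁ refl
... | +[1+ 0 ]     | _ | _              = inj₂ refl
... | +[1+ suc _ ] | _ | ℤ.+≤+ (s≤s ())

p≤q⇒0≤q-p : ∀ {p q} → p ≤ℚ q → 0ℚ ≤ℚ q - p
p≤q⇒0≤q-p {p} {q} p≤q = subst (_≤ℚ q - p) (+-inverseʳ p) (+-monoˡ-≤ (- p) p≤q)

p<q⇒0<q-p : ∀ {p q} → p <ℚ q → 0ℚ <ℚ q - p
p<q⇒0<q-p {p} {q} p<q = subst (_<ℚ q - p) (+-inverseʳ p) (+-monoˡ-< (- p) p<q)

0≤p*q : ∀ {p q} → 0ℚ ≤ℚ p → 0ℚ ≤ℚ q → 0ℚ ≤ℚ p * q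
0≤p*q {p} {q} 0≤p 0≤q =
  nonNegative⁻¹ (p * q) {{nonNeg*nonNeg⇒nonNeg p {{nonNegative 0≤p}} q {{nonNegative 0≤q}}}}

p+q≡0⇒p≡0 : ∀ {p q} → 0ℚ ≤ℚ p → 0ℚ ≤ℚ q → p + q ≡ 0ℚ → p ≡ 0ℚ
p+q≡0⇒p≡0 {p} {q} 0≤p 0≤q p+q≡0 =
  ≤-antisym (subst₂ _≤ℚ_ (+-identityʳ p) p+q≡0 (+-monoʳ-≤ p 0≤q)) 0≤p

r*p≡0⇒p≡0 : ∀ {r p} → 0ℚ <ℚ r → r * p ≡ 0ℚ → p ≡ 0ℚ
r*p≡0⇒p≡0 {r} {p} 0<r r*p≡0 = ≤-antisym (cancel (≤-reflexive (trans r*p≡0 (sym (*-zeroʳ r)))))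
                                             (cancel (≤-reflexive (trans (*-zeroʳ r) (sym r*p≡0))))
  where
  cancel : ∀ {a b} → r * a ≤ℚ r * b → a ≤ℚ b
  cancel = *-cancelˡ-≤-pos r {{positive 0<r}}

module _ {t : ℚ} (0<t : 0ℚ <ℚ t) (t<1 : t <ℚ 1ℚ) where

  convex-combination≡0 : ∀ {a b} → 0ℚ ≤ℚ a → 0ℚ ≤ℚ b →
                        t * a + (1ℚ - t) * b ≡ 0ℚ → a ≡ 0ℚ × b ≡ 0ℚ
  convex-combination≡0 {a} {b} 0≤a 0≤b sum≡0 =
    r*p≡0⇒p≡0 0<t (p+q≡0⇒p≡0 0≤ta 0≤sb sum≡0) ,
    r*p≡0⇒p≡0 0<s (p+q≡0⇒p≡0 0≤sb 0≤ta (trans (+-comm ((1ℚ - t) * b) (t * a)) sum≡0))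
    where
    0<s : 0ℚ <ℚ 1ℚ - t
    0<s = p<q⇒0<q-p t<1
    0≤ta : 0ℚ ≤ℚ t * a
    0≤ta = 0≤p*q (<⇒≤ 0<t) 0≤a
    0≤sb : 0ℚ ≤ℚ (1ℚ - t) * b
    0≤sb = 0≤p*q (<⇒≤ 0<s) 0≤b

  convex-combination≡1 : ∀ {a b} → a ≤ℚ 1ℚ → b ≤ℚ 1ℚ →
                        t * a + (1ℚ - t) * b ≡ 1ℚ → a ≡ 1ℚ × b ≡ 1ℚ
  convex-combination≡1 {a} {b} a≤1 b≤1 sum≡1 =
    let 1-a≡0 , 1-b≡0 = convex-combination≡0 (p≤q⇒0≤q-p a≤1) (p≤q⇒0≤q-p b≤1) reflected≡0
    in sym (x∙y⁻¹≈ε⇒x≈y 1ℚ a 1-a≡0) , sym (x∙y⁻¹≈ε⇒x≈y 1ℚ b 1-b≡0)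
    where
    open +-*-Solver
    reflect : ∀ t a b → t * (1ℚ - a) + (1ℚ - t) * (1ℚ - b) ≡ 1ℚ - (t * a + (1ℚ - t) * b)
    reflect = solve 3 (λ t a b → t :* (con 1ℚ :- a) :+ (con 1ℚ :- t) :* (con 1ℚ :- b)
                             := con 1ℚ :- (t :* a :+ (con 1ℚ :- t) :* b)) refl
    reflected≡0 : t * (1ℚ - a) + (1ℚ - t) * (1ℚ - b) ≡ 0ℚ
    reflected≡0 = begin
      t * (1ℚ - a) + (1ℚ - t) * (1ℚ - b) ≡⟨ reflect t a b ⟩
      1ℚ - (t * a + (1ℚ - t) * b)         ≡⟨ cong (_-_ 1ℚ) sum≡1 ⟩
      1ℚ - 1ℚ                             ≡⟨ +-inverseʳ 1ℚ ⟩
      0ℚ                                  ∎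
      where open ≡-Reasoning

  endpoints-extreme : ∀ {a b c} → 0ℚ ≤ℚ a × a ≤ℚ 1ℚ → 0ℚ ≤ℚ b × b ≤ℚ 1ℚ → c ≡ 0ℚ ⊎ c ≡ 1ℚ →
                c ≡ t * a + (1ℚ - t) * b → a ≡ c × b ≡ c
  endpoints-extreme (0≤a , _)   (0≤b , _)   (inj₁ refl) c≡ = convex-combination≡0 0≤a 0≤b (sym c≡)
  endpoints-extreme (_   , a≤1) (_   , b≤1) (inj₂ refl) c≡ = convex-combination≡1 a≤1 b≤1 (sym c≡)

sumℚ-sub : ∀ n (f g : Fin n → ℚ) → sumℚ n (λ j → f j - g j) ≡ sumℚ n f - sumℚ n g
sumℚ-sub zero    f g = refl
sumℚ-sub (suc n) f g = begin
  (f zero - g zero) + sumℚ n (λ j → f (suc j) - g (suc j))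
    ≡⟨ cong (_+_ (f zero - g zero)) (sumℚ-sub n (f ∘ suc) (g ∘ suc)) ⟩
  (f zero - g zero) + (sumℚ n (f ∘ suc) - sumℚ n (g ∘ suc))
    ≡⟨ interchange (f zero) (g zero) (sumℚ n (f ∘ suc)) (sumℚ n (g ∘ suc)) ⟩
  (f zero + sumℚ n (f ∘ suc)) - (g zero + sumℚ n (g ∘ suc))
    ∎
  where
  open ≡-Reasoning
  open +-*-Solver
  interchange : ∀ a b c d → (a - b) + (c - d) ≡ (a + c) - (b + d)
  interchange = solve 4 (λ a b c d → (a :- b) :+ (c :- d) := (a :+ c) :- (b :+ d)) refl

sumℚ-nonneg : ∀ n (f : Fin n → ℚ) → (∀ j → 0ℚ ≤ℚ f j) → 0ℚ ≤ℚ sumℚ n f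
sumℚ-nonneg zero    f 0≤f = ≤-refl
sumℚ-nonneg (suc n) f 0≤f = +-mono-≤ (0≤f zero) (sumℚ-nonneg n (f ∘ suc) (0≤f ∘ suc))

term≤sumℚ : ∀ n (f : Fin n → ℚ) → (∀ j → 0ℚ ≤ℚ f j) → ∀ j → f j ≤ℚ sumℚ n f
term≤sumℚ (suc n) f 0≤f zero    = subst (_≤ℚ sumℚ (suc n) f) (+-identityʳ (f zero))
  (+-monoʳ-≤ (f zero) (sumℚ-nonneg n (f ∘ suc) (0≤f ∘ suc)))
term≤sumℚ (suc n) f 0≤f (suc j) = ≤-trans (term≤sumℚ n (f ∘ suc) (0≤f ∘ suc) j)
  (subst (_≤ℚ sumℚ (suc n) f) (+-identityˡ (sumℚ n (f ∘ suc)))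
    (+-monoˡ-≤ (sumℚ n (f ∘ suc)) (0≤f zero)))

rowStep : ∀ {k n} → Array k n → Fin k → Fin n → ℚ
rowStep x i j = x (suc i) j - x (inject₁ i) j

0≤rowStep : ∀ {k n} (x : Array k n) → IsGT x → ∀ i j → 0ℚ ≤ℚ rowStep x i j
0≤rowStep x (x-GT , _) i j = p≤q⇒0≤q-p (x-GT i j)

rowStep≤rowSumStep : ∀ {k n} (x : Array k n) → IsGT x →
                     ∀ i j → rowStep x i j ≤ℚ rowSum x (suc i) - rowSum x (inject₁ i)
rowStep≤rowSumStep {n = n} x x-GT i j =
  subst (rowStep x i j ≤ℚ_) (sumℚ-sub n (x (suc i)) (x (inject₁ i)))
  (term≤sumℚ n (rowStep x i) (0≤rowStep x x-GT i) j)

rowStep-integral : ∀ {k n} {x : Array k n} → IsIntegral x → ∀ i j → IsInteger (rowStep x i j)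
rowStep-integral x-int i j = IsInteger-− (x-int (suc i) j) (x-int (inject₁ i) j)

rowStep-convex : ∀ {k n} (x y z : Array k n) t → (∀ i j → x i j ≡ t * y i j + (1ℚ - t) * z i j) →
                 ∀ i j → rowStep x i j ≡ t * rowStep y i j + (1ℚ - t) * rowStep z i j
rowStep-convex x y z t x≡ i j =
  trans (cong₂ _-_ (x≡ (suc i) j) (x≡ (inject₁ i) j)) (linear t _ _ _ _)
  where
  open +-*-Solver
  linear : ∀ t a b c d → (t * a + (1ℚ - t) * b) - (t * c + (1ℚ - t) * d)
                         ≡ t * (a - c) + (1ℚ - t) * (b - d)
  linear = solve 5 (λ t a b c d → (t :* a :+ (con 1ℚ :- t) :* b) :- (t :* c :+ (con 1ℚ :- t) :* d)
                              := t :* (a :- c) :+ (con 1ℚ :- t) :* (b :- d)) refl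

≡-by-bottomRow-rowStep : ∀ {k n} (x y : Array k n) → (∀ j → y zero j ≡ x zero j) →
                         (∀ i j → rowStep y i j ≡ rowStep x i j) → ∀ i j → y i j ≡ x i j
≡-by-bottomRow-rowStep x y bottom≡ step≡ = <-weakInduction (λ i → ∀ j → y i j ≡ x i j) bottom≡ next
  where
  next : ∀ i → (∀ j → y (inject₁ i) j ≡ x (inject₁ i) j) → ∀ j → y (suc i) j ≡ x (suc i) j
  next i below≡ j = ∙-cancelʳ (- x (inject₁ i) j) (y (suc i) j) (x (suc i) j)
    (subst (λ v → y (suc i) j - v ≡ rowStep x i j) (below≡ j) (step≡ i j))

integral⇒vertex : ∀ {k n} (lam mu : Vec ℕ n) (x : Array k n) →
                  InGTPolytope lam mu (ones k) x → IsIntegral x →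
                  IsVertex (InGTPolytope lam mu (ones k)) x
integral⇒vertex {k} {n} lam mu x x∈P@(_ , _ , x₀≡mu , _) x-int =
  x∈P , λ y z t y∈P z∈P 0<t t<1 x≡ty+sz →
  let steps≡ i j = endpoints-extreme 0<t t<1 (rowStep∈[0,1] y y∈P i j) (rowStep∈[0,1] z z∈P i j)
                     (rowStep≡0∨1 i j) (rowStep-convex x y z t x≡ty+sz i j)
  in ≡-by-bottomRow-rowStep x y (bottom≡ y y∈P) (λ i j → proj₁ (steps≡ i j)) ,
     ≡-by-bottomRow-rowStep x z (bottom≡ z z∈P) (λ i j → proj₂ (steps≡ i j))
  where
  P : Array k n → Set
  P = InGTPolytope lam mu (ones k)

  bottom≡ : ∀ y → P y → ∀ j → y zero j ≡ x zero j
  bottom≡ y (_ , _ , y₀≡mu , _) j = trans (y₀≡mu j) (sym (x₀≡mu j))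

  rowStep∈[0,1] : ∀ y → P y → ∀ i j → 0ℚ ≤ℚ rowStep y i j × rowStep y i j ≤ℚ 1ℚ
  rowStep∈[0,1] y (y-GT , _ , _ , rowSumStep≡1) i j =
    0≤rowStep y y-GT i j ,
    subst (rowStep y i j ≤ℚ_) (rowSumStep≡1 i) (rowStep≤rowSumStep y y-GT i j)

  rowStep≡0∨1 : ∀ i j → rowStep x i j ≡ 0ℚ ⊎ rowStep x i j ≡ 1ℚ
  rowStep≡0∨1 i j = let 0≤step , step≤1 = rowStep∈[0,1] x x∈P i j
                    in integer∈[0,1]⇒0∨1 (rowStep-integral x-int i j) 0≤step step≤1

mainTheorem7 : ∀ (n : ℕ) (lam mu : Vec ℕ n) →
    IsPartition lam → IsPartition mu →
    (∀ (j : Fin n) → lookup mu j ≤ lookup lam j) →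
    let k = size lam ∸ size mu in
    ∀ (x : Array k n) →
    InGTPolytope lam mu (ones k) x → IsIntegral x →
    IsVertex (InGTPolytope lam mu (ones k)) x
mainTheorem7 n lam mu _ _ _ = integral⇒vertex lam mu
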